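{- Fix an integer $t\ge 2$. For every integer $d\ge 2$ with $d\equiv 1\pmod{t-1}$, there exists a $d$-regular bipartite graph $G=(V,E)$ with $|E| = d\cdot\left(\frac{d-1}{t-1}+1\right)^{t-1}$ and $\chi'_t(G)=|E|$.
   Context: Graphs are finite and simple. The line graph $L(G)$ of $G=(V,E)$ has vertex set $E$, two distinct edges being adjacent if they share an endpoint. For a graph $F$, $F^t$ is the graph on $V(F)$ in which two distinct vertices are adjacent if they are joined by a path in $F$ of length at most $t$. The distance-$t$ chromatic index is $\chi'_t(G)=\chi((L(G))^t)$. -}

module Defs where

open import Data.Nat using (ℕ; zero; suc; _+_; _*_; _∸_; _^_; _≤_)
open import Data.Fin using (Fin; _<_)
open import Data.Bool using (Bool; true)
open import Data.Product using (Σ; _×_; _,_; proj₁; proj₂; ∃-syntax)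
open import Data.List using (List; []; _∷_)
open import Data.List.Relation.Unary.Unique.Propositional using (Unique)
open import Data.Empty using (⊥)
open import Relation.Nullary using (¬_)
open import Relation.Binary.PropositionalEquality using (_≡_; _≢_)
open import Function.Bundles using (_↔_)

record Graph (n : ℕ) : Set where
  field
    adj   : Fin n → Fin n → Bool
    sym   : ∀ u v → adj u v ≡ true → adj v u ≡ true
    irref : ∀ v → ¬ (adj v v ≡ true)
open Graph public

module _ {n : ℕ} (G : Graph n) where

  -- An edge {u,v} is represented uniquely by its ordered endpoints u < v.
  Edge : Set
  Edge = Σ (Fin n × Fin n) λ p → (proj₁ p < proj₂ p) × (adj G (proj₁ p) (proj₂ p) ≡ true)

  ends : Edge → Fin n × Fin n
  ends = proj₁

  LAdj : Edge → Edge → Set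
  LAdj e f = (ends e ≢ ends f) ×
    ( (proj₁ (ends e) ≡ proj₁ (ends f)) Data.Sum.⊎ (proj₁ (ends e) ≡ proj₂ (ends f))
      Data.Sum.⊎ (proj₂ (ends e) ≡ proj₁ (ends f)) Data.Sum.⊎ (proj₂ (ends e) ≡ proj₂ (ends f)) )
    where import Data.Sum

  data LWalk : Edge → Edge → ℕ → Set where
    here : ∀ e → LWalk e e 0
    step : ∀ {e g f k} → LAdj e g → LWalk g f k → LWalk e f (suc k)

  walkVerts : ∀ {e f k} → LWalk e f k → List (Fin n × Fin n)
  walkVerts (here e) = ends e ∷ []
  walkVerts (step {e = e} _ w) = ends e ∷ walkVerts w

  LPath : Edge → Edge → ℕ → Set
  LPath e f k = Σ (LWalk e f k) λ w → Unique (walkVerts w)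

  LPowAdj : ℕ → Edge → Edge → Set
  LPowAdj t e f = (ends e ≢ ends f) × ∃[ k ] (k ≤ t × LPath e f k)

  DistColouring : ℕ → ℕ → Set
  DistColouring t k = Σ (Edge → Fin k) λ c → ∀ e f → LPowAdj t e f → c e ≢ c f

  -- χ'_t(G) = χ((L(G))^t) equals m: m colours suffice and no fewer do
  DistChromaticIndex≡ : ℕ → ℕ → Set
  DistChromaticIndex≡ t m = DistColouring t m × (∀ k → DistColouring t k → m ≤ k)

  NumEdges≡ : ℕ → Set
  NumEdges≡ m = Fin m ↔ Edge

  Regular : ℕ → Set
  Regular d = ∀ v → Fin d ↔ Σ (Fin n) (λ u → adj G v u ≡ true)

  Bipartite : Set
  Bipartite = Σ (Fin n → Bool) λ side → ∀ u v → adj G u v ≡ true → side u ≢ side v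

-- Take the bipartite double cover of the graph on words of length s = t − 1 over
-- an alphabet of size q + 1 in which two words are adjacent when they differ in at
-- most one letter (loops included). It is d-regular with d = 1 + qs, and any two
-- words are joined by a walk of exactly s steps, changing one letter at a time.
-- Lifting such a walk to the double cover shows that any two edges are joined in
-- the line graph by a walk of length s + 1 = t, so (L G)^t is complete and every
-- edge needs its own colour.
module Submission where

open import Data.Nat using (ℕ; zero; suc; _+_; _*_; _∸_; _^_; _≤_; z≤n; s≤s)
import Data.Nat as ℕ
open import Data.Nat.Properties using (≤-refl; ≤-trans; m≤n⇒m≤1+n; m≤m+n; +-suc; +-comm; *-comm)
open import Data.Fin as Fin using (Fin; zero; suc; _<_; punchIn; punchOut; toℕ; _↑ˡ_; _↑ʳ_; splitAt)
open import Data.Fin.Properties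
  using (<-cmp; <-asym; <-irrelevant; toℕ<n; toℕ-↑ˡ; toℕ-↑ʳ; ↑ˡ-injective; ↑ʳ-injective;
         splitAt-↑ˡ; splitAt-↑ʳ; splitAt⁻¹-↑ˡ; splitAt⁻¹-↑ʳ; +↔⊎; *↔×; injective⇒≤;
         punchInᵢ≢i; punchIn-punchOut; punchOut-punchIn; punchOut-cong)
open import Data.Vec using (Vec; []; _∷_)
import Data.Vec.Properties as Vec
open import Data.Bool as Bool using (Bool; true; false; if_then_else_)
open import Data.Sum using (_⊎_; inj₁; inj₂)
open import Data.Sum.Function.Propositional using (_⊎-↔_)
open import Data.Product using (Σ; _×_; _,_; proj₁; proj₂; ∃-syntax; uncurry)
open import Data.Product.Properties using (≡-dec)
open import Data.Product.Algebra using (×-comm)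
open import Data.Product.Function.NonDependent.Propositional using (_×-↔_)
open import Data.Product.Function.Dependent.Propositional using (Σ-↔)
open import Data.List.Relation.Unary.Any using (here; there)
open import Data.List.Relation.Unary.All using ([])
open import Data.List.Relation.Unary.All.Properties using (¬Any⇒All¬)
open import Data.List.Relation.Unary.AllPairs using ([]; _∷_)
open import Data.List.Relation.Unary.Unique.Propositional using (Unique)
open import Data.List.Membership.Propositional using (_∈_; _∉_)
open import Relation.Nullary using (Dec; yes; no; does; contradiction)
open import Relation.Nullary.Decidable using (dec-true; does-⇔)
open import Relation.Binary using (tri<; tri≈; tri>)
open import Relation.Binary.PropositionalEquality
  using (_≡_; _≢_; refl; sym; trans; cong; cong₂; subst; subst₂)
open import Axiom.UniquenessOfIdentityProofs using (module Decidable⇒UIP)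
open import Function.Bundles using (_↔_; Inverse; Injection; mk↔ₛ′; mk⇔)
open import Function.Base using (_∘′_)
open import Function.Properties.Inverse using (↔-refl; ↔-sym; ↔-trans; ↔⇒↣)
open import Defs hiding (sym)

open Decidable⇒UIP Bool._≟_ renaming (≡-irrelevant to Bool-UIP)

Σ-≡-true : {A : Set} {P : A → Bool} {a a′ : A} {p : P a ≡ true} {p′ : P a′ ≡ true} →
           a ≡ a′ → _≡_ {A = Σ A λ x → P x ≡ true} (a , p) (a′ , p′)
Σ-≡-true refl = cong (_ ,_) (Bool-UIP _ _)

Fin-cong : {m n : ℕ} → m ≡ n → Fin m ↔ Fin n
Fin-cong refl = ↔-refl

Fin^↔Vec : ∀ {m} s → Fin (m ^ s) ↔ Vec (Fin m) s
Fin^↔Vec zero    = mk↔ₛ′ (λ _ → []) (λ _ → zero) (λ { [] → refl }) (λ { zero → refl })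
Fin^↔Vec (suc s) = ↔-trans *↔× (↔-trans (↔-refl ×-↔ Fin^↔Vec s)
  (mk↔ₛ′ (uncurry _∷_) (λ { (x ∷ xs) → x , xs }) (λ { (x ∷ xs) → refl }) (λ _ → refl)))

data Walk {A : Set} (_~_ : A → A → Set) : A → A → ℕ → Set where
  []  : ∀ {x} → Walk _~_ x x 0
  _∷_ : ∀ {x y z k} → x ~ y → Walk _~_ y z k → Walk _~_ x z (suc k)

Walk-map : {A B : Set} {_~_ : A → A → Set} {_≈_ : B → B → Set} (f : A → B) →
           (∀ {x y} → x ~ y → f x ≈ f y) → ∀ {x y k} → Walk _~_ x y k → Walk _≈_ (f x) (f y) k
Walk-map f f-hom []      = []
Walk-map f f-hom (p ∷ w) = f-hom p ∷ Walk-map f f-hom w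

module LineGraph {n : ℕ} (G : Graph n) where

  open import Data.List.Membership.DecPropositional (≡-dec (Fin._≟_ {n}) (Fin._≟_ {n})) using (_∈?_)

  data _∈ₑ_ (u : Fin n) (e : Edge G) : Set where
    first  : u ≡ proj₁ (ends G e) → u ∈ₑ e
    second : u ≡ proj₂ (ends G e) → u ∈ₑ e

  Meet : Edge G → Edge G → Set
  Meet e f = (proj₁ (ends G e) ≡ proj₁ (ends G f)) ⊎ (proj₁ (ends G e) ≡ proj₂ (ends G f))
           ⊎ (proj₂ (ends G e) ≡ proj₁ (ends G f)) ⊎ (proj₂ (ends G e) ≡ proj₂ (ends G f))

  meet : ∀ {u e f} → u ∈ₑ e → u ∈ₑ f → Meet e f
  meet (first u≡e₁) (first u≡f₁) = inj₁ (trans (sym u≡e₁) u≡f₁)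
  meet (first u≡e₁) (second u≡f₂) = inj₂ (inj₁ (trans (sym u≡e₁) u≡f₂))
  meet (second u≡e₂) (first u≡f₁) = inj₂ (inj₂ (inj₁ (trans (sym u≡e₂) u≡f₁)))
  meet (second u≡e₂) (second u≡f₂) = inj₂ (inj₂ (inj₂ (trans (sym u≡e₂) u≡f₂)))

  ends-injective : ∀ {e f} → ends G e ≡ ends G f → e ≡ f
  ends-injective {_ , u<v , uv} {_ , u<v′ , uv′} refl =
    cong₂ (λ a b → _ , a , b) (<-irrelevant u<v u<v′) (Bool-UIP uv uv′)

  edge-between : ∀ {u v} → adj G u v ≡ true → Σ (Edge G) λ e → u ∈ₑ e × v ∈ₑ e
  edge-between {u} {v} uv with <-cmp u v
  ... | tri< u<v _ _ = ((u , v) , u<v , uv) , first refl , second refl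
  ... | tri≈ _ refl _ = contradiction uv (irref G u)
  ... | tri> _ _ v<u = ((v , u) , v<u , Graph.sym G u v uv) , second refl , first refl

  walk⇒meet-walk : ∀ {u v k e f} → u ∈ₑ e → v ∈ₑ f →
                   Walk (λ x y → adj G x y ≡ true) u v k → Walk Meet e f (suc k)
  walk⇒meet-walk u∈e u∈f []        = meet u∈e u∈f ∷ []
  walk⇒meet-walk u∈e v∈f (uw ∷ ws) with edge-between uw
  ... | g , u∈g , w∈g = meet u∈e u∈g ∷ walk⇒meet-walk w∈g v∈f ws

  PathWithin : Edge G → Edge G → ℕ → Set
  PathWithin e f k = ∃[ k′ ] k′ ≤ k × LPath G e f k′

  ∉walkVerts⇒≢start : ∀ {e g f k} (p : LWalk G g f k) → ends G e ∉ walkVerts G p → ends G e ≢ ends G g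
  ∉walkVerts⇒≢start (here _)   e∉p e≡g = e∉p (here e≡g)
  ∉walkVerts⇒≢start (step _ _) e∉p e≡g = e∉p (here e≡g)

  starting-at : ∀ {e g f k} → ends G e ≡ ends G g → LPath G g f k → PathWithin e f k
  starting-at {e} {g} e≡g p =
    subst (λ x → PathWithin x _ _) (sym (ends-injective {e} {g} e≡g)) (_ , ≤-refl , p)

  suffix : ∀ {e g f k} (p : LWalk G g f k) → Unique (walkVerts G p) →
           ends G e ∈ walkVerts G p → PathWithin e f k
  suffix p@(here _)   u (here e≡g) = starting-at e≡g (p , u)
  suffix p@(step _ _) u (here e≡g) = starting-at e≡g (p , u)
  suffix (step _ p) (_ ∷ u) (there e∈p) with suffix p u e∈p
  ... | k′ , k′≤k , q = k′ , m≤n⇒m≤1+n k′≤k , q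

  -- A meeting walk becomes a path by cutting out the loop at each repeated edge.
  walk⇒path : ∀ {e f k} → Walk Meet e f k → PathWithin e f k
  walk⇒path {e} [] = 0 , z≤n , here e , [] ∷ []
  walk⇒path {e} (e~g ∷ w) with walk⇒path w
  ... | k , k≤ , p , u with ends G e ∈? walkVerts G p
  ...   | no e∉p  = suc k , s≤s k≤ , step (∉walkVerts⇒≢start {e} p e∉p , e~g) p , ¬Any⇒All¬ _ e∉p ∷ u
  ...   | yes e∈p with suffix p u e∈p
  ...     | k′ , k′≤ , q = k′ , m≤n⇒m≤1+n (≤-trans k′≤ k≤) , q

  linked⇒DistChromaticIndex≡ : ∀ {m t} → NumEdges≡ G m → (∀ e f → ∃[ k ] k ≤ t × Walk Meet e f k) →
                      DistChromaticIndex≡ G t m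
  linked⇒DistChromaticIndex≡ {m} {t} numbering linked = colouring , fewest
    where
    open Inverse numbering

    colouring : DistColouring G t m
    colouring = from , λ e f (e≢f , _) →
      e≢f ∘′ cong (ends G) ∘′ Injection.injective (↔⇒↣ (↔-sym numbering))

    injective-colouring : ∀ {k} ((c , _) : DistColouring G t k) → ∀ {e f} → c e ≡ c f → e ≡ f
    injective-colouring (c , proper) {e} {f} ce≡cf with ≡-dec Fin._≟_ Fin._≟_ (ends G e) (ends G f)
    ... | yes e≡f = ends-injective e≡f
    ... | no  e≢f with linked e f
    ...   | k , k≤t , w with walk⇒path w
    ...     | k′ , k′≤k , p = contradiction ce≡cf (proper e f (e≢f , k′ , ≤-trans k′≤k k≤t , p))

    fewest : ∀ k → DistColouring G t k → m ≤ k
    fewest k c = injective⇒≤ (Injection.injective (↔⇒↣ numbering) ∘′ injective-colouring c)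

module HammingBall (q : ℕ) where

  Word : ℕ → Set
  Word = Vec (Fin (suc q))

  _≟ʷ_ : ∀ {s} (x y : Word s) → Dec (x ≡ y)
  _≟ʷ_ = Vec.≡-dec Fin._≟_

  -- Hamming distance at most one: after the first differing letter the words agree.
  near : ∀ {s} → Word s → Word s → Bool
  near []       []       = true
  near (x ∷ xs) (y ∷ ys) = if does (x Fin.≟ y) then near xs ys else does (xs ≟ʷ ys)

  Near : ∀ {s} → Word s → Word s → Set
  Near x y = near x y ≡ true

  Ball : ∀ {s} → Word s → Set
  Ball x = Σ (Word _) (Near x)

  ≟ʷ-sound : ∀ {s} {xs ys : Word s} → does (xs ≟ʷ ys) ≡ true → xs ≡ ys
  ≟ʷ-sound {xs = xs} {ys} p with xs ≟ʷ ys | p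
  ... | yes xs≡ys | _ = xs≡ys
  ... | no _      | ()

  near-refl : ∀ {s} (x : Word s) → Near x x
  near-refl []       = refl
  near-refl (x ∷ xs) with x Fin.≟ x
  ... | yes _  = near-refl xs
  ... | no x≢x = contradiction refl x≢x

  near-sym : ∀ {s} (x y : Word s) → near x y ≡ near y x
  near-sym []       []       = refl
  near-sym (x ∷ xs) (y ∷ ys) with x Fin.≟ y | y Fin.≟ x
  ... | yes _   | yes _   = near-sym xs ys
  ... | no _    | no _    = does-⇔ (mk⇔ sym sym) (xs ≟ʷ ys) (ys ≟ʷ xs)
  ... | yes x≡y | no y≢x  = contradiction (sym x≡y) y≢x
  ... | no x≢y  | yes y≡x = contradiction (sym y≡x) x≢y

  near-∷-same : ∀ {s} (z : Fin (suc q)) (xs ys : Word s) → near (z ∷ xs) (z ∷ ys) ≡ near xs ys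
  near-∷-same z xs ys with z Fin.≟ z
  ... | yes _  = refl
  ... | no z≢z = contradiction refl z≢z

  near-∷-head : ∀ {s} (x y : Fin (suc q)) (zs : Word s) → Near (x ∷ zs) (y ∷ zs)
  near-∷-head x y zs with x Fin.≟ y
  ... | yes _ = near-refl zs
  ... | no _  = dec-true (zs ≟ʷ zs) refl

  word-walk : ∀ {s} (x y : Word s) → Walk Near x y s
  word-walk []       []       = []
  word-walk (x ∷ xs) (y ∷ ys) =
    near-∷-head x y xs ∷ Walk-map (y ∷_) (λ {a} {b} → trans (near-∷-same y a b)) (word-walk xs ys)

  Ball-∷ : ∀ {s} (x : Fin (suc q)) (xs : Word s) → Ball (x ∷ xs) ↔ (Fin q ⊎ Ball xs)
  Ball-∷ x xs = mk↔ₛ′ split unsplit split∘unsplit unsplit∘split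
    where
    split-at : ∀ {y ys} (x≟y : Dec (x ≡ y)) →
               (if does x≟y then near xs ys else does (xs ≟ʷ ys)) ≡ true → Fin q ⊎ Ball xs
    split-at {ys = ys} (yes _) p = inj₂ (ys , p)
    split-at (no x≢y) _          = inj₁ (punchOut x≢y)

    split : Ball (x ∷ xs) → Fin q ⊎ Ball xs
    split (y ∷ ys , p) = split-at (x Fin.≟ y) p

    unsplit : Fin q ⊎ Ball xs → Ball (x ∷ xs)
    unsplit (inj₁ j)        = punchIn x j ∷ xs , near-∷-head x (punchIn x j) xs
    unsplit (inj₂ (ys , p)) = x ∷ ys , trans (near-∷-same x xs ys) p

    split-punchIn : ∀ {j} (x≟y : Dec (x ≡ punchIn x j)) p → split-at x≟y p ≡ inj₁ j
    split-punchIn {j} (yes x≡y) _ = contradiction (sym x≡y) (punchInᵢ≢i x j)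
    split-punchIn     (no x≢y)  _ = cong inj₁ (trans (punchOut-cong x refl) (punchOut-punchIn x))

    split-same : ∀ {ys} (p₀ : Near xs ys) (x≟x : Dec (x ≡ x)) p → split-at x≟x p ≡ inj₂ (ys , p₀)
    split-same _ (yes _)  _ = cong inj₂ (Σ-≡-true refl)
    split-same _ (no x≢x) _ = contradiction refl x≢x

    split∘unsplit : ∀ z → split (unsplit z) ≡ z
    split∘unsplit (inj₁ j)        = split-punchIn (x Fin.≟ punchIn x j) _
    split∘unsplit (inj₂ (ys , p)) = split-same p (x Fin.≟ x) _

    unsplit-split : ∀ {y ys} (x≟y : Dec (x ≡ y)) p → proj₁ (unsplit (split-at x≟y p)) ≡ y ∷ ys
    unsplit-split (yes refl) _ = refl
    unsplit-split (no x≢y)   p = cong₂ _∷_ (punchIn-punchOut x≢y) (≟ʷ-sound p)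

    unsplit∘split : ∀ y → unsplit (split y) ≡ y
    unsplit∘split (y ∷ ys , p) = Σ-≡-true (unsplit-split (x Fin.≟ y) p)

  Ball-size : ∀ {s} (x : Word s) → Fin (1 + s * q) ↔ Ball x
  Ball-size [] = mk↔ₛ′ (λ _ → [] , refl) (λ _ → zero) (λ { ([] , refl) → refl }) (λ { zero → refl })
  Ball-size {suc s} (x ∷ xs) =
    ↔-trans (Fin-cong (sym (+-suc q (s * q))))
      (↔-trans +↔⊎ (↔-trans (↔-refl ⊎-↔ Ball-size xs) (↔-sym (Ball-∷ x xs))))

module DoubleCover {N : ℕ} (R : Fin N → Fin N → Bool) (R-sym : ∀ {i j} → R i j ≡ true → R j i ≡ true) where

  _∼_ : Fin N → Fin N → Set
  i ∼ j = R i j ≡ true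

  Adj : Fin N ⊎ Fin N → Fin N ⊎ Fin N → Bool
  Adj (inj₁ i) (inj₁ j) = false
  Adj (inj₁ i) (inj₂ j) = R i j
  Adj (inj₂ i) (inj₁ j) = R j i
  Adj (inj₂ i) (inj₂ j) = false

  Adj-sym : ∀ a b → Adj a b ≡ true → Adj b a ≡ true
  Adj-sym (inj₁ i) (inj₂ j) p = p
  Adj-sym (inj₂ i) (inj₁ j) p = p

  Adj-irrefl : ∀ a → Adj a a ≢ true
  Adj-irrefl (inj₁ i) ()
  Adj-irrefl (inj₂ i) ()

  graph : Graph (N + N)
  graph = record
    { adj   = λ u v → Adj (splitAt N u) (splitAt N v)
    ; sym   = λ u v → Adj-sym (splitAt N u) (splitAt N v)
    ; irref = λ v → Adj-irrefl (splitAt N v)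
    }

  open LineGraph graph

  onRight : Fin N ⊎ Fin N → Bool
  onRight (inj₁ _) = false
  onRight (inj₂ _) = true

  bipartite : Bipartite graph
  bipartite = (λ u → onRight (splitAt N u)) , λ u v → sides-differ (splitAt N u) (splitAt N v)
    where
    sides-differ : ∀ a b → Adj a b ≡ true → onRight a ≢ onRight b
    sides-differ (inj₁ i) (inj₂ j) _ ()
    sides-differ (inj₂ i) (inj₁ j) _ ()

  index : Fin N ⊎ Fin N → Fin N
  index (inj₁ i) = i
  index (inj₂ i) = i

  neighbours : ∀ a → Σ (Fin N ⊎ Fin N) (λ b → Adj a b ≡ true) ↔ Σ (Fin N) (index a ∼_)
  neighbours (inj₁ i) = mk↔ₛ′ (λ { (inj₁ j , ()) ; (inj₂ j , r) → j , r }) (λ (j , r) → inj₂ j , r)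
    (λ _ → refl) (λ { (inj₁ j , ()) ; (inj₂ j , r) → refl })
  neighbours (inj₂ i) = mk↔ₛ′ (λ { (inj₁ j , r) → j , R-sym r ; (inj₂ j , ()) }) (λ (j , r) → inj₁ j , R-sym r)
    (λ _ → Σ-≡-true refl) (λ { (inj₁ j , r) → Σ-≡-true refl ; (inj₂ j , ()) })

  regular : ∀ {d} → (∀ i → Fin d ↔ Σ (Fin N) (i ∼_)) → Regular graph d
  regular degree u = ↔-trans (degree (index (splitAt N u)))
    (↔-trans (↔-sym (neighbours (splitAt N u))) (↔-sym (Σ-↔ +↔⊎ ↔-refl)))

  data Side : Set where
    left right : Side

  opposite : Side → Side
  opposite left  = right
  opposite right = left

  side-after : ℕ → Side → Side
  side-after zero    σ = σ
  side-after (suc k) σ = side-after k (opposite σ)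

  vertex : Side → Fin N → Fin (N + N)
  vertex left  i = i ↑ˡ N
  vertex right i = N ↑ʳ i

  adj-vertex : ∀ σ {i j} → i ∼ j → adj graph (vertex σ i) (vertex (opposite σ) j) ≡ true
  adj-vertex left  {i} {j} r rewrite splitAt-↑ˡ N i N | splitAt-↑ʳ N N j = r
  adj-vertex right {i} {j} r rewrite splitAt-↑ʳ N N i | splitAt-↑ˡ N j N = R-sym r

  lift : ∀ {i j k} → Walk _∼_ i j k → ∀ σ →
         Walk (λ u v → adj graph u v ≡ true) (vertex σ i) (vertex (side-after k σ) j) k
  lift []      σ = []
  lift (r ∷ w) σ = adj-vertex σ r ∷ lift w (opposite σ)

  left<right : ∀ i j → vertex left i < vertex right j
  left<right i j = subst₂ ℕ._<_ (sym (toℕ-↑ˡ i N)) (sym (toℕ-↑ʳ N j))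
                          (≤-trans (toℕ<n i) (m≤m+n N (toℕ j)))

  Arc : Set
  Arc = Σ (Fin N) λ i → Σ (Fin N) (i ∼_)

  edge : Arc → Edge graph
  edge (i , j , r) = (vertex left i , vertex right j) , left<right i j , adj-vertex left r

  edge-injective : ∀ {a b} → edge a ≡ edge b → a ≡ b
  edge-injective {i , j , _} {i′ , j′ , _} e≡e′
    with ↑ˡ-injective N i i′ (cong (proj₁ ∘′ proj₁) e≡e′) | ↑ʳ-injective N j j′ (cong (proj₂ ∘′ proj₁) e≡e′)
  ... | refl | refl = cong (λ r → i , j , r) (Bool-UIP _ _)

  edge-view : ∀ e → Σ Arc λ a → e ≡ edge a
  edge-view e@((u , v) , u<v , uv) = classify (splitAt N u) (splitAt N v) refl refl uv
    where
    classify : ∀ a b → splitAt N u ≡ a → splitAt N v ≡ b → Adj a b ≡ true → Σ Arc λ x → e ≡ edge x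
    classify (inj₁ i) (inj₂ j) u≡ v≡ r =
      (i , j , r) , ends-injective (cong₂ _,_ (sym (splitAt⁻¹-↑ˡ u≡)) (sym (splitAt⁻¹-↑ʳ v≡)))
    classify (inj₂ i) (inj₁ j) u≡ v≡ _ = contradiction
      (subst₂ _<_ (sym (splitAt⁻¹-↑ʳ u≡)) (sym (splitAt⁻¹-↑ˡ v≡)) u<v) (<-asym (left<right j i))

  Arc↔Edge : Arc ↔ Edge graph
  Arc↔Edge = mk↔ₛ′ edge (λ e → proj₁ (edge-view e)) (λ e → sym (proj₂ (edge-view e)))
                   (λ a → edge-injective (sym (proj₂ (edge-view (edge a)))))

  edge-count : ∀ {d} → (∀ i → Fin d ↔ Σ (Fin N) (i ∼_)) → NumEdges≡ graph (d * N)
  edge-count degree = ↔-trans *↔× (↔-trans (×-comm _ _) (↔-trans (Σ-↔ ↔-refl (degree _)) Arc↔Edge))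

  corner : Side → Arc → Fin N
  corner left  (i , _ , _) = i
  corner right (_ , j , _) = j

  corner∈ₑ : ∀ σ a → vertex σ (corner σ a) ∈ₑ edge a
  corner∈ₑ left  _ = first refl
  corner∈ₑ right _ = second refl

  -- Walk from the left end of e; the parity of s decides which end of f is reached.
  linked : ∀ {s} → (∀ i j → Walk _∼_ i j s) → ∀ e f → Walk Meet e f (suc s)
  linked {s} connected e f with edge-view e | edge-view f
  ... | a , refl | b , refl =
    walk⇒meet-walk (corner∈ₑ left a) (corner∈ₑ σ b) (lift (connected (corner left a) (corner σ b)) left)
    where σ = side-after s left

module HammingDoubleCover (q s : ℕ) where

  open HammingBall q

  N : ℕ
  N = suc q ^ s

  open Inverse (Fin^↔Vec {suc q} s) renaming (to to word; from to code)

  open DoubleCover (λ i j → near (word i) (word j)) (λ {i} {j} → trans (near-sym (word j) (word i))) public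

  degree : ∀ i → Fin (1 + s * q) ↔ Σ (Fin N) (i ∼_)
  degree i = ↔-trans (Ball-size (word i)) (↔-sym (Σ-↔ (Fin^↔Vec s) ↔-refl))

  connected : ∀ i j → Walk _∼_ i j s
  connected i j = subst₂ (λ a b → Walk _∼_ a b s) (strictlyInverseʳ i) (strictlyInverseʳ j)
    (Walk-map code (subst₂ Near (sym (strictlyInverseˡ _)) (sym (strictlyInverseˡ _)))
      (word-walk (word i) (word j)))

proposition10 : (t : ℕ) → 2 ≤ t → (d : ℕ) → 2 ≤ d → (q : ℕ) → d ≡ 1 + q * (t ∸ 1) →
    ∃[ n ] Σ (Graph n) λ G → Regular G d × Bipartite G ×
      NumEdges≡ G (d * (q + 1) ^ (t ∸ 1)) × DistChromaticIndex≡ G t (d * (q + 1) ^ (t ∸ 1))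
proposition10 zero ()
proposition10 (suc zero) (s≤s ())
proposition10 (suc (suc s′)) _ d _ q d≡ rewrite +-comm q 1 =
  N + N , graph , regular degree′ , bipartite , edge-count degree′ ,
  LineGraph.linked⇒DistChromaticIndex≡ graph (edge-count degree′)
    (λ e f → suc s , ≤-refl , linked connected e f)
  where
  s : ℕ
  s = suc s′
  open HammingDoubleCover q s

  degree′ : ∀ i → Fin d ↔ Σ (Fin N) (i ∼_)
  degree′ i = ↔-trans (Fin-cong (trans d≡ (cong suc (*-comm q s)))) (degree i)
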